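{- Let $v$ be a node of the r-suffix trie $\mathcal{T}$ of $T$ with $v \notin \hat{V}$. Then $v$ is not the deepest matching node for any non-empty string.
   Context: Let $T$ be a string of length $n$ over an alphabet $\Sigma$. A run of $T$ is a maximal substring $T[i..j]$ consisting of a single repeated character; a position $i$ is a run boundary if some run of $T$ starts at $i$. The r-suffix trie $\mathcal{T}$ of $T$ is the (uncompacted) trie of all suffixes $T[i..n]$ such that $i$ is a run boundary; its nodes correspond one-to-one to the prefixes of these suffixes (including the empty prefix at the root). $V$ is its set of nodes. For a node $v$, $\mathsf{str}(v)$ is the string spelled by the path from the root to $v$, and $\mathsf{d}(v)=|\mathsf{str}(v)|$. For a character $c$ and integer $e\ge 0$, $c^e$ denotes $c$ repeated $e$ times. $\hat{V}\subseteq V$ is the set of nodes $v$ that have no child $v'$ with $\mathsf{str}(v') = c^e$ for some character $c$ and integer $e \ge 1$. A node $v$ is a matching node for a non-empty string $w$ iff $\mathsf{str}(v) = w[1]^e w$ for some integer $e \ge 0$; the deepest matching node for $w$ is the matching node for $w$ of maximum depth. -}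

module Defs where

open import Data.Nat using (ℕ; zero; suc; _≤_; _<_; _≥_)
open import Data.List using (List; []; _∷_; _++_; length; drop; replicate; lookup)
open import Data.Fin using (Fin; toℕ)
open import Data.Product using (Σ; ∃; ∃-syntax; _×_; _,_)
open import Data.Sum using (_⊎_)
open import Relation.Binary.PropositionalEquality using (_≡_; _≢_)
open import Relation.Nullary using (¬_)

-- The text T is a list over an alphabet A; positions are 0-indexed.
-- Position i of T is a run boundary iff a maximal run starts at i, i.e.
-- i = 0 (and T non-empty) or T[i-1] ≠ T[i].
RunBoundary : {A : Set} → (T : List A) → ℕ → Set
RunBoundary T i =
  Σ (i < length T) λ _ →
    (i ≡ 0) ⊎
    (Σ ℕ λ j → Σ (suc j ≡ i) λ _ → Σ (Fin (length T)) λ p → Σ (Fin (length T)) λ q →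
       (toℕ p ≡ j) × (toℕ q ≡ i) × (lookup T p ≢ lookup T q))

Prefix : {A : Set} → List A → List A → Set
Prefix s t = ∃[ u ] (s ++ u ≡ t)

-- Nodes of the r-suffix trie are identified with the strings they spell:
-- the prefixes of suffixes T[i..] with i a run boundary, plus the empty
-- string (the root).
IsNode : {A : Set} → List A → List A → Set
IsNode T s = (s ≡ []) ⊎ (∃[ i ] (RunBoundary T i × Prefix s (drop i T)))

Node : {A : Set} → List A → Set
Node {A} T = Σ (List A) λ s → IsNode T s

str : {A : Set} {T : List A} → Node T → List A
str (s , _) = s

d : {A : Set} {T : List A} → Node T → ℕ
d v = length (str v)

Child : {A : Set} {T : List A} → Node T → Node T → Set
Child {A} v' v = ∃[ c ] (str v' ≡ str v ++ (c ∷ []))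

HasUnaryChild : {A : Set} {T : List A} → Node T → Set
HasUnaryChild {A} {T} v =
  Σ (Node T) λ v' → Child v' v × (Σ A λ c → Σ ℕ λ e → (e ≥ 1) × (str v' ≡ replicate e c))

InVHat : {A : Set} {T : List A} → Node T → Set
InVHat v = ¬ HasUnaryChild v

Matching : {A : Set} {T : List A} → Node T → A → List A → Set
Matching v x w' = ∃[ e ] (str v ≡ replicate e x ++ (x ∷ w'))

DeepestMatching : {A : Set} {T : List A} → Node T → A → List A → Set
DeepestMatching {A} {T} v x w' =
  Matching v x w' × ((u : Node T) → Matching u x w' → d u ≤ d v)

-- A node outside V̂ has a child spelling c^e, so the node itself spells
-- c^(e-1) and that child is c ∷ str v.  A matching node for x w' starts with
-- x, hence x = c, and prepending c to a matching string keeps it matching: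
-- the child is a strictly deeper matching node.
module Submission where

open import Defs
open import Data.List using (List; []; _∷_; _++_; _∷ʳ_; length; replicate)
open import Data.List.Relation.Unary.All as All using (All; []; _∷_)
open import Data.List.Relation.Unary.All.Properties using (replicate⁺; ++⁻ʳ; ∷ʳ⁻)
open import Data.Nat using (suc; _≤_)
open import Data.Nat.Properties using (1+n≰n)
open import Data.Product using (Σ; _×_; _,_)
open import Relation.Binary.PropositionalEquality
  using (_≡_; refl; sym; trans; cong; subst)
open import Relation.Nullary using (¬_)

∷ʳ-constant : {A : Set} {c : A} {s : List A} → All (_≡ c) s → s ∷ʳ c ≡ c ∷ s
∷ʳ-constant []             = refl
∷ʳ-constant (refl ∷ all≡c) = cong (_ ∷_) (∷ʳ-constant all≡c)

unaryChild⇒constant : {A : Set} {T : List A} (v : Node T) → HasUnaryChild v →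
  Σ A λ c → All (_≡ c) (str v) × (Σ (Node T) λ v' → str v' ≡ c ∷ str v)
unaryChild⇒constant v (v' , (c' , v'≡v∷ʳc') , c , e , _ , v'≡cᵉ)
  with all≡c , refl ← ∷ʳ⁻ (subst (All (_≡ c)) (trans (sym v'≡cᵉ) v'≡v∷ʳc')
                                             (replicate⁺ e refl))
  = c , all≡c , v' , trans v'≡v∷ʳc' (∷ʳ-constant all≡c)

Matching⇒head : {A : Set} {T : List A} (v : Node T) {x : A} {w' : List A}
  {P : A → Set} → Matching v x w' → All P (str v) → P x
Matching⇒head v {x} {P = P} (k , v≡xᵏxw') all =
  All.head (++⁻ʳ (replicate k x) (subst (All P) v≡xᵏxw' all))

Matching-∷ : {A : Set} {T : List A} (u v : Node T) {x : A} {w' : List A} →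
  Matching v x w' → str u ≡ x ∷ str v → Matching u x w'
Matching-∷ u v {x} (k , v≡xᵏxw') u≡x∷v = suc k , trans u≡x∷v (cong (x ∷_) v≡xᵏxw')

lemma2 : {A : Set} (T : List A) (v : Node T) → HasUnaryChild v →
         (x : A) (w' : List A) → ¬ DeepestMatching v x w'
lemma2 T v unary x w' (matchV , deepest)
  with c , all≡c , v' , v'≡c∷v ← unaryChild⇒constant v unary
  with refl ← Matching⇒head v matchV all≡c
  = 1+n≰n (subst (_≤ d v) (cong length v'≡c∷v)
                  (deepest v' (Matching-∷ v' v matchV v'≡c∷v)))
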